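{- Let $m,n\in\mathbb{N}$. The set of faces of $T_n$ of dimension $m$ is in bijection with the set of dimension-preserving graph morphisms $T_m\to T_n$ that are injective on vertices.
   Context: A graph is $(V,E)$ with $E\subseteq V\times V$; a graph morphism $(V,E)\to(V',E')$ is $f:V\to V'$ with $(s,t)\in E\Rightarrow(f(s),f(t))\in E'$, sending edge $(s,t)$ to edge $(f(s),f(t))$. The twisted $n$-cube $T_n$ has vertex set $\{0,1\}^n$ and edges: a loop at each vertex, and for each $i\in\{0,\dots,n-1\}$ and $y\in\{0,1\}^{n-1}$ an edge from $y_0\cdots y_{i-1}\,b\,y_i\cdots y_{n-2}$ to $y_0\cdots y_{i-1}\,(1-b)\,y_i\cdots y_{n-2}$, where $b=1$ if the number of zeros among $y_0,\dots,y_{i-1}$ is odd and $b=0$ otherwise. The dimension of a loop is "trivial"; that of a non-loop edge joining vertices differing in coordinate $i$ is $i$. A graph morphism $g:T_m\to T_n$ is dimension-preserving if any two edges of $T_m$ with equal dimension are sent to edges with equal dimension. A face of $T_n$ is a function $f:\{0,\dots,n-1\}\to\{0,1,\star\}$; its dimension is the number of $i$ with $f(i)=\star$. -}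

module Defs where

open import Level using (0ℓ)
open import Data.Bool using (Bool; true; false; not; _xor_)
open import Data.Nat using (ℕ; zero; suc; _+_)
open import Data.Fin using (Fin; zero; suc)
open import Data.Vec using (Vec; []; _∷_; insertAt)
open import Data.Maybe using (Maybe; nothing; just; map)
open import Data.Product using (Σ; _×_; proj₁)
open import Relation.Binary.PropositionalEquality using (_≡_; refl; sym; trans)
open import Relation.Binary.Bundles using (Setoid)
open import Function.Definitions using (Injective)

-- Vertices of T_n: bit strings of length n (false = 0, true = 1).
Vertex : ℕ → Set
Vertex n = Vec Bool n

zerosParity : ∀ {k} → Fin (suc k) → Vec Bool k → Bool
zerosParity zero    _        = false
zerosParity (suc i) (x ∷ y)  = not x xor zerosParity i y

data Edge : {n : ℕ} → Vertex n → Vertex n → Set where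
  loop : ∀ {n} (v : Vertex n) → Edge v v
  step : ∀ {k} (i : Fin (suc k)) (y : Vec Bool k) →
         Edge (insertAt y i (zerosParity i y)) (insertAt y i (not (zerosParity i y)))

-- On non-loop edges of T_n the
-- endpoints differ in exactly one coordinate, so this is that coordinate.
dim : ∀ {n} → Vertex n → Vertex n → Maybe (Fin n)
dim []       []       = nothing
dim (true ∷ s)  (true ∷ t)  = map suc (dim s t)
dim (false ∷ s) (false ∷ t) = map suc (dim s t)
dim (true ∷ s)  (false ∷ t) = just zero
dim (false ∷ s) (true ∷ t)  = just zero

IsGraphMorphism : ∀ {m n} → (Vertex m → Vertex n) → Set
IsGraphMorphism {m} f = ∀ {s t : Vertex m} → Edge s t → Edge (f s) (f t)

IsDimPreserving : ∀ {m n} → (Vertex m → Vertex n) → Set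
IsDimPreserving {m} f =
  ∀ {s₁ t₁ s₂ t₂ : Vertex m} → Edge s₁ t₁ → Edge s₂ t₂ →
  dim s₁ t₁ ≡ dim s₂ t₂ → dim (f s₁) (f t₁) ≡ dim (f s₂) (f t₂)

record DPInjMorphism (m n : ℕ) : Set where
  field
    fun        : Vertex m → Vertex n
    morphism   : IsGraphMorphism fun
    dimPres    : IsDimPreserving fun
    injective  : Injective _≡_ _≡_ fun

open DPInjMorphism public

-- two morphisms are equal iff they agree on vertices (edges are pairs of vertices)
DPInjMorphismSetoid : ℕ → ℕ → Setoid 0ℓ 0ℓ
DPInjMorphismSetoid m n = record
  { Carrier = DPInjMorphism m n
  ; _≈_ = λ f g → ∀ v → fun f v ≡ fun g v
  ; isEquivalence = record
    { refl = λ v → refl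
    ; sym = λ p v → sym (p v)
    ; trans = λ p q v → trans (p v) (q v) } }

data FaceVal : Set where
  f0 f1 ⋆ : FaceVal

Face : ℕ → Set
Face n = Fin n → FaceVal

isStar : FaceVal → ℕ
isStar ⋆  = 1
isStar f0 = 0
isStar f1 = 0

faceDim : ∀ {n} → Face n → ℕ
faceDim {zero}  f = 0
faceDim {suc n} f = isStar (f zero) + faceDim (λ i → f (suc i))

FaceSetoid : ℕ → ℕ → Setoid 0ℓ 0ℓ
FaceSetoid n m = record
  { Carrier = Σ (Face n) (λ f → faceDim f ≡ m)
  ; _≈_ = λ f g → ∀ i → proj₁ f i ≡ proj₁ g i
  ; isEquivalence = record
    { refl = λ i → refl
    ; sym = λ p i → sym (p i)
    ; trans = λ p q i → trans (p i) (q i) } }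

-- A face S of dimension m embeds T_m into T_n: the free coordinates of S carry
-- the coordinates of T_m, each xor-ed with the zero-parity accumulated from the
-- fixed coordinates before it, which is exactly what keeps twisted edges twisted.
-- Conversely, let g be a dimension-preserving injective morphism. All edges of
-- direction 0 go to edges of one dimension. If that dimension is 0, then g sends
-- coordinate 0 to coordinate 0 (up to the twist) and the rest of g factors through
-- the remaining coordinates; otherwise the first coordinate of g is constant,
-- since an edge of another direction moving it would, together with its mirror
-- image, force the wrong orientation on an image edge. Induction on n then reads
-- off the face, and distinct faces give distinct embeddings.
module Submission where

open import Defs
open import Data.Nat using (ℕ; zero; suc)
open import Data.Nat.Properties using (suc-injective)
open import Data.Bool using (Bool; true; false; not; _xor_)
open import Data.Bool.Properties
  using (_≟_; not-involutive; not-injective; not-¬; not-distribˡ-xor; not-distribʳ-xor;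
         xor-assoc; xor-comm; xor-identityʳ; xor-inverseˡ)
open import Data.Fin using (Fin; zero; suc; lift)
import Data.Fin.Properties as Fin
open import Data.Vec using (Vec; []; _∷_; head; tail; insertAt; replicate)
open import Data.Vec.Properties using (∷-injectiveˡ; ∷-injectiveʳ)
open import Data.Maybe using (nothing; just; map)
open import Data.Maybe.Properties using (map-∘; map-injective)
open import Data.Product using (_×_; _,_; proj₁; proj₂; ∃; ∃₂)
open import Data.Sum using (_⊎_; inj₁; inj₂; [_,_]′)
open import Data.Empty using (⊥-elim)
open import Function using (_∘_; id)
open import Function.Bundles using (Bijection)
open import Function.Definitions using (Injective)
open import Function.Properties.Bijection using (Bijection⇒Inverse)
open import Function.Properties.Inverse using (Inverse⇒Bijection)
import Function.Construct.Composition as Composition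
import Function.Construct.Symmetry as Symmetry
open import Relation.Nullary using (yes; no)
open import Relation.Binary.PropositionalEquality
  using (_≡_; _≢_; refl; sym; trans; cong; subst; _≗_; setoid)

private
  variable
    n m : ℕ
    a c h : Bool

Bool-cases : (P : Bool → Set) → P a → P (not a) → ∀ x → P x
Bool-cases {false} P pa pna false = pa
Bool-cases {false} P pa pna true  = pna
Bool-cases {true}  P pa pna false = pna
Bool-cases {true}  P pa pna true  = pa

xor-shift : ∀ u z a → (u xor z) xor a ≡ z xor (u xor a)
xor-shift u z a = trans (cong (_xor a) (xor-comm u z)) (xor-assoc z u a)

xor-twist : ∀ c x a → not (c xor x) xor (c xor a) ≡ not x xor a
xor-twist false x a = refl
xor-twist true  x a =
  trans (cong (_xor not a) (not-involutive x))
        (trans (sym (not-distribʳ-xor x a)) (not-distribˡ-xor x a))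

xor-cancelˡ : ∀ c {x y} → c xor x ≡ c xor y → x ≡ y
xor-cancelˡ false p = p
xor-cancelˡ true  p = not-injective p

head-tail-≡ : {w₁ w₂ : Vertex (suc n)} → head w₁ ≡ head w₂ → tail w₁ ≡ tail w₂ → w₁ ≡ w₂
head-tail-≡ {w₁ = x ∷ s} {y ∷ t} refl refl = refl

-- Non-loop edges of the twisted cube with the parity of zeros started at a
-- instead of 0; for a = false these are exactly the non-loop edges of T_n.
data Step : Bool → Vertex n → Vertex n → Set where
  here  : ∀ a (v : Vertex n) → Step a (a ∷ v) (not a ∷ v)
  there : ∀ x {s t : Vertex n} → Step (not x xor a) s t → Step a (x ∷ s) (x ∷ t)

Step-insertAt : ∀ a (i : Fin (suc n)) (y : Vertex n) →
  Step a (insertAt y i (zerosParity i y xor a)) (insertAt y i (not (zerosParity i y xor a)))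
Step-insertAt a zero    y       = here a y
Step-insertAt a (suc i) (x ∷ y) rewrite xor-shift (not x) (zerosParity i y) a =
  there x (Step-insertAt (not x xor a) i y)

Step-insertAt⁻¹ : {s t : Vertex (suc n)} → Step a s t →
  ∃₂ λ i y → s ≡ insertAt y i (zerosParity i y xor a)
           × t ≡ insertAt y i (not (zerosParity i y xor a))
Step-insertAt⁻¹ (here a v) = zero , v , refl , refl
Step-insertAt⁻¹ {n = suc n} {a = a} (there x e) with Step-insertAt⁻¹ e
... | i , y , refl , refl =
  suc i , x ∷ y , cong (λ b → x ∷ insertAt y i b) shift , cong (λ b → x ∷ insertAt y i (not b)) shift
  where shift = sym (xor-shift (not x) (zerosParity i y) a)

Step⇒Edge : {s t : Vertex n} → Step false s t → Edge s t
Step⇒Edge {n = suc n} e with Step-insertAt⁻¹ e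
... | i , y , refl , refl rewrite xor-identityʳ (zerosParity i y) = step i y

Edge⇒Step : {s t : Vertex n} → Edge s t → s ≡ t ⊎ Step false s t
Edge⇒Step (loop v) = inj₁ refl
Edge⇒Step (step i y) with Step-insertAt false i y
... | e rewrite xor-identityʳ (zerosParity i y) = inj₂ e

Step-irrefl : {s t : Vertex n} → Step a s t → s ≢ t
Step-irrefl (here a v)  p = not-¬ refl (∷-injectiveˡ p)
Step-irrefl (there x e) p = Step-irrefl e (∷-injectiveʳ p)

Step-reverse : {s t : Vertex n} → Step a s t → Step (not a) t s
Step-reverse (here a v) =
  subst (λ b → Step (not a) (not a ∷ v) (b ∷ v)) (not-involutive a) (here (not a) v)
Step-reverse {a = a} (there x e) =
  there x (subst (λ b → Step b _ _) (not-distribʳ-xor (not x) a) (Step-reverse e))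

Step-at-head : {w₁ w₂ : Vertex (suc n)} → Step a w₁ w₂ → head w₁ ≢ head w₂ →
               head w₁ ≡ a × head w₂ ≡ not a × tail w₁ ≡ tail w₂
Step-at-head (here a v)  _ = refl , refl , refl
Step-at-head (there x e) p = ⊥-elim (p refl)

Step-tail : {w₁ w₂ : Vertex (suc n)} → Step a w₁ w₂ → head w₁ ≡ h → head w₂ ≡ h →
            Step (not h xor a) (tail w₁) (tail w₂)
Step-tail (here a v)  p q = ⊥-elim (not-¬ refl (trans p (sym q)))
Step-tail (there x e) refl q = e

constant-along-Step : {A : Set} (q : Vertex n → A) →
  (∀ {s t} → Step a s t → q s ≡ q t) → ∀ v w → q v ≡ q w
constant-along-Step q H [] [] = refl
constant-along-Step {a = a} q H (x ∷ v) (y ∷ w) =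
  trans (constant-along-Step (λ u → q (x ∷ u)) (H ∘ there x) v w)
        (trans (toBase x) (sym (toBase y)))
  where
  toBase : ∀ z → q (z ∷ w) ≡ q (a ∷ w)
  toBase = Bool-cases (λ z → q (z ∷ w) ≡ q (a ∷ w)) refl (sym (H (here a w)))

dim-sym : (s t : Vertex n) → dim s t ≡ dim t s
dim-sym []          []          = refl
dim-sym (true  ∷ s) (true  ∷ t) = cong (map suc) (dim-sym s t)
dim-sym (true  ∷ s) (false ∷ t) = refl
dim-sym (false ∷ s) (true  ∷ t) = refl
dim-sym (false ∷ s) (false ∷ t) = cong (map suc) (dim-sym s t)

dim-head-≡ : (w₁ w₂ : Vertex (suc n)) → head w₁ ≡ head w₂ →
             dim w₁ w₂ ≡ map suc (dim (tail w₁) (tail w₂))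
dim-head-≡ (true  ∷ s) (.true  ∷ t) refl = refl
dim-head-≡ (false ∷ s) (.false ∷ t) refl = refl

dim-head-≢ : (w₁ w₂ : Vertex (suc n)) → head w₁ ≢ head w₂ → dim w₁ w₂ ≡ just zero
dim-head-≢ (true  ∷ s) (true  ∷ t) p = ⊥-elim (p refl)
dim-head-≢ (true  ∷ s) (false ∷ t) p = refl
dim-head-≢ (false ∷ s) (true  ∷ t) p = refl
dim-head-≢ (false ∷ s) (false ∷ t) p = ⊥-elim (p refl)

dim-∷-cong : ∀ x y {s₁ t₁ s₂ t₂ : Vertex n} → dim s₁ t₁ ≡ dim s₂ t₂ →
             dim (x ∷ s₁) (x ∷ t₁) ≡ dim (y ∷ s₂) (y ∷ t₂)
dim-∷-cong x y {s₁} {t₁} {s₂} {t₂} d =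
  trans (dim-head-≡ (x ∷ s₁) (x ∷ t₁) refl)
        (trans (cong (map suc) d) (sym (dim-head-≡ (y ∷ s₂) (y ∷ t₂) refl)))

dim-∷-not : ∀ x (s t : Vertex n) → dim (x ∷ s) (not x ∷ t) ≡ just zero
dim-∷-not true  s t = refl
dim-∷-not false s t = refl

dim≡just-zero⇒head-≢ : (w₁ w₂ : Vertex (suc n)) → dim w₁ w₂ ≡ just zero → head w₁ ≢ head w₂
dim≡just-zero⇒head-≢ w₁ w₂ p q with dim (tail w₁) (tail w₂) | trans (sym (dim-head-≡ w₁ w₂ q)) p
... | nothing | ()
... | just _  | ()

dim≢just-zero⇒head-≡ : (w₁ w₂ : Vertex (suc n)) → dim w₁ w₂ ≢ just zero → head w₁ ≡ head w₂
dim≢just-zero⇒head-≡ w₁ w₂ p with head w₁ ≟ head w₂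
... | yes q = q
... | no  q = ⊥-elim (p (dim-head-≢ w₁ w₂ q))

dim-tails : (w₁ w₂ w₃ w₄ : Vertex (suc n)) → head w₁ ≡ head w₂ → head w₃ ≡ head w₄ →
            dim w₁ w₂ ≡ dim w₃ w₄ → dim (tail w₁) (tail w₂) ≡ dim (tail w₃) (tail w₄)
dim-tails w₁ w₂ w₃ w₄ p q d =
  map-injective Fin.suc-injective
    (trans (sym (dim-head-≡ w₁ w₂ p)) (trans d (dim-head-≡ w₃ w₄ q)))

data Subcube : ℕ → ℕ → Set where
  []  : Subcube 0 0
  ⋆∷_ : Subcube n m → Subcube (suc n) (suc m)
  _∷_ : Bool → Subcube n m → Subcube (suc n) m

fixedFaceVal : Bool → FaceVal
fixedFaceVal false = f0
fixedFaceVal true  = f1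

fixedFaceVal-injective : ∀ b b′ → fixedFaceVal b ≡ fixedFaceVal b′ → b ≡ b′
fixedFaceVal-injective false false _ = refl
fixedFaceVal-injective true  true  _ = refl

⋆≢fixedFaceVal : ∀ b → ⋆ ≢ fixedFaceVal b
⋆≢fixedFaceVal false ()
⋆≢fixedFaceVal true  ()

toFace : Subcube n m → Face n
toFace (⋆∷ S)  zero    = ⋆
toFace (b ∷ S) zero    = fixedFaceVal b
toFace (⋆∷ S)  (suc i) = toFace S i
toFace (b ∷ S) (suc i) = toFace S i

faceDim-toFace : (S : Subcube n m) → faceDim (toFace S) ≡ m
faceDim-toFace []          = refl
faceDim-toFace (⋆∷ S)      = cong suc (faceDim-toFace S)
faceDim-toFace (false ∷ S) = faceDim-toFace S
faceDim-toFace (true  ∷ S) = faceDim-toFace S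

toFace-injective : (S T : Subcube n m) → (∀ i → toFace S i ≡ toFace T i) → S ≡ T
toFace-injective []          []          p = refl
toFace-injective (⋆∷ S)      (⋆∷ T)      p = cong ⋆∷_ (toFace-injective S T (p ∘ suc))
toFace-injective (b ∷ S)     (b′ ∷ T)    p with refl ← fixedFaceVal-injective b b′ (p zero) =
  cong (b ∷_) (toFace-injective S T (p ∘ suc))
toFace-injective (⋆∷ S)      (b ∷ T)     p = ⊥-elim (⋆≢fixedFaceVal b (p zero))
toFace-injective (b ∷ S)     (⋆∷ T)      p = ⊥-elim (⋆≢fixedFaceVal b (sym (p zero)))

toFace-surjective : (F : Face n) → faceDim F ≡ m → ∃ λ (S : Subcube n m) → ∀ i → toFace S i ≡ F i
toFace-surjective {zero}  F refl = [] , λ ()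
toFace-surjective {suc n} F p with F zero in F₀
toFace-surjective {suc n} {suc m} F p | ⋆
  with S , q ← toFace-surjective (F ∘ suc) (suc-injective p)
  = ⋆∷ S , λ { zero → sym F₀ ; (suc i) → q i }
toFace-surjective {suc n} F p | f0
  with S , q ← toFace-surjective (F ∘ suc) p
  = false ∷ S , λ { zero → sym F₀ ; (suc i) → q i }
toFace-surjective {suc n} F p | f1
  with S , q ← toFace-surjective (F ∘ suc) p
  = true ∷ S , λ { zero → sym F₀ ; (suc i) → q i }

faceBijection : Bijection (setoid (Subcube n m)) (FaceSetoid n m)
faceBijection = record
  { to        = λ S → toFace S , faceDim-toFace S
  ; cong      = λ { refl i → refl }
  ; bijective = (λ {S} {T} → toFace-injective S T)
              , λ (F , p) → let S , q = toFace-surjective F p in S , λ { refl → q }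
  }

-- The twist c is the difference of the zero-parities read so far in the target
-- and in the source.
embed : Bool → Subcube n m → Vertex m → Vertex n
embed c []      []      = []
embed c (⋆∷ S)  (x ∷ v) = (c xor x) ∷ embed false S v
embed c (b ∷ S) v       = b ∷ embed (not b xor c) S v

starPosition : Subcube n m → Fin m → Fin n
starPosition (⋆∷ S)  = lift 1 (starPosition S)
starPosition (b ∷ S) = suc ∘ starPosition S

embed-Step : (S : Subcube n m) {s t : Vertex m} → Step a s t →
             Step (c xor a) (embed c S s) (embed c S t)
embed-Step {c = c} (⋆∷ S) (here a v) =
  subst (λ b → Step (c xor a) ((c xor a) ∷ _) (b ∷ _)) (not-distribʳ-xor c a) (here (c xor a) _)
embed-Step {a = a} {c = c} (⋆∷ S) (there x e) =
  there (c xor x) (subst (λ b → Step b _ _) (sym (xor-twist c x a)) (embed-Step S e))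
embed-Step {a = a} {c = c} (b ∷ S) e =
  there b (subst (λ d → Step d _ _) (xor-assoc (not b) c a) (embed-Step S e))

dim-xor-heads : ∀ c x y (s t : Vertex n) → dim ((c xor x) ∷ s) ((c xor y) ∷ t) ≡ dim (x ∷ s) (y ∷ t)
dim-xor-heads false x     y     s t = refl
dim-xor-heads true  true  true  s t = refl
dim-xor-heads true  true  false s t = refl
dim-xor-heads true  false true  s t = refl
dim-xor-heads true  false false s t = refl

map-suc-lift : ∀ (ρ : Fin m → Fin n) d → map suc (map ρ d) ≡ map (lift 1 ρ) (map suc d)
map-suc-lift ρ d = trans (sym (map-∘ d)) (map-∘ d)

dim-∷-lift : ∀ (ρ : Fin m → Fin n) x y {s t : Vertex m} {u w : Vertex n} →
             dim u w ≡ map ρ (dim s t) → dim (x ∷ u) (y ∷ w) ≡ map (lift 1 ρ) (dim (x ∷ s) (y ∷ t))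
dim-∷-lift ρ true  true  {s} {t} p = trans (cong (map suc) p) (map-suc-lift ρ (dim s t))
dim-∷-lift ρ false false {s} {t} p = trans (cong (map suc) p) (map-suc-lift ρ (dim s t))
dim-∷-lift ρ true  false p = refl
dim-∷-lift ρ false true  p = refl

embed-dim : ∀ c (S : Subcube n m) (s t : Vertex m) →
            dim (embed c S s) (embed c S t) ≡ map (starPosition S) (dim s t)
embed-dim c []      []      []      = refl
embed-dim c (⋆∷ S)  (x ∷ s) (y ∷ t) =
  trans (dim-xor-heads c x y _ _) (dim-∷-lift (starPosition S) x y (embed-dim false S s t))
embed-dim c (b ∷ S) s       t       =
  trans (dim-head-≡ (b ∷ _) (b ∷ _) refl)
        (trans (cong (map suc) (embed-dim (not b xor c) S s t)) (sym (map-∘ (dim s t))))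

embed-injective : ∀ c (S : Subcube n m) → Injective _≡_ _≡_ (embed c S)
embed-injective c []      {[]}    {[]}    p = refl
embed-injective c (⋆∷ S)  {x ∷ s} {y ∷ t} p
  with refl ← xor-cancelˡ c (∷-injectiveˡ p) = cong (x ∷_) (embed-injective false S (∷-injectiveʳ p))
embed-injective c (b ∷ S) p = embed-injective (not b xor c) S (∷-injectiveʳ p)

embed-determines-Subcube : ∀ c (S T : Subcube n m) → embed c S ≗ embed c T → S ≡ T
embed-determines-Subcube c []      []      p = refl
embed-determines-Subcube c (⋆∷ S)  (⋆∷ T)  p =
  cong ⋆∷_ (embed-determines-Subcube false S T (λ u → ∷-injectiveʳ (p (false ∷ u))))
embed-determines-Subcube {m = m} c (b ∷ S) (b′ ∷ T) p
  with refl ← ∷-injectiveˡ (p (replicate m false)) =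
  cong (b ∷_) (embed-determines-Subcube (not b xor c) S T (∷-injectiveʳ ∘ p))
embed-determines-Subcube {m = suc m} c (⋆∷ S) (b ∷ T) p
  with () ← xor-cancelˡ c (trans (∷-injectiveˡ (p (false ∷ replicate m false)))
                                 (sym (∷-injectiveˡ (p (true ∷ replicate m false)))))
embed-determines-Subcube {m = suc m} c (b ∷ S) (⋆∷ T) p
  with () ← xor-cancelˡ c (trans (sym (∷-injectiveˡ (p (false ∷ replicate m false))))
                                 (∷-injectiveˡ (p (true ∷ replicate m false))))

embedding : Subcube n m → DPInjMorphism m n
embedding S = record
  { fun       = embed false S
  ; morphism  = λ e → [ (λ { refl → loop _ }) , Step⇒Edge ∘ embed-Step S ]′ (Edge⇒Step e)
  ; dimPres   = λ {s₁} {t₁} {s₂} {t₂} _ _ d →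
      trans (embed-dim false S s₁ t₁)
            (trans (cong (map (starPosition S)) d) (sym (embed-dim false S s₂ t₂)))
  ; injective = embed-injective false S
  }

record IsCubeEmbedding (a c : Bool) (g : Vertex m → Vertex n) : Set where
  field
    preserves-Step : ∀ {s t} → Step a s t → Step (c xor a) (g s) (g t)
    preserves-dim  : ∀ {s₁ t₁ s₂ t₂} → Step a s₁ t₁ → Step a s₂ t₂ →
                     dim s₁ t₁ ≡ dim s₂ t₂ → dim (g s₁) (g t₁) ≡ dim (g s₂) (g t₂)
    vertex-injective : Injective _≡_ _≡_ g

open IsCubeEmbedding

Vertex₀-unique : (w : Vertex 0) → [] ≡ w
Vertex₀-unique [] = refl

DPInjMorphism⇒IsCubeEmbedding : (g : DPInjMorphism m n) → IsCubeEmbedding false false (fun g)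
DPInjMorphism⇒IsCubeEmbedding g = record
  { preserves-Step   = λ e → [ (λ p → ⊥-elim (Step-irrefl e (injective g p))) , id ]′
                               (Edge⇒Step (morphism g (Step⇒Edge e)))
  ; preserves-dim    = λ e₁ e₂ → dimPres g (Step⇒Edge e₁) (Step⇒Edge e₂)
  ; vertex-injective = injective g
  }

module _ {g : Vertex m → Vertex (suc n)} (E : IsCubeEmbedding a c g) where

  tail-embedding : (∀ v → head (g v) ≡ h) → IsCubeEmbedding a (not h xor c) (tail ∘ g)
  tail-embedding {h} hc = record
    { preserves-Step   = λ {s} {t} e →
        subst (λ d → Step d _ _) (sym (xor-assoc (not h) c a))
              (Step-tail (preserves-Step E e) (hc s) (hc t))
    ; preserves-dim    = λ {s₁} {t₁} {s₂} {t₂} e₁ e₂ d →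
        dim-tails (g s₁) (g t₁) (g s₂) (g t₂) (same-head s₁ t₁) (same-head s₂ t₂)
                  (preserves-dim E e₁ e₂ d)
    ; vertex-injective = λ {s} {t} p → vertex-injective E (head-tail-≡ (same-head s t) p)
    }
    where
    same-head : ∀ s t → head (g s) ≡ head (g t)
    same-head s t = trans (hc s) (sym (hc t))

  prepend-fixed : (∀ v → head (g v) ≡ h) → (∃ λ S → embed (not h xor c) S ≗ tail ∘ g) →
                  ∃ λ S → embed c S ≗ g
  prepend-fixed {h} hc (S , p) = h ∷ S , λ v → head-tail-≡ (sym (hc v)) (p v)

module _ {g : Vertex (suc m) → Vertex (suc n)} (E : IsCubeEmbedding a c g) where

  private
    u₀ : Vertex m
    u₀ = replicate m false

  here-dim : ∀ u → dim (g (a ∷ u)) (g (not a ∷ u)) ≡ dim (g (a ∷ u₀)) (g (not a ∷ u₀))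
  here-dim u = preserves-dim E (here a u) (here a u₀)
                             (trans (dim-∷-not a u u) (sym (dim-∷-not a u₀ u₀)))

  module _ (splits : head (g (a ∷ u₀)) ≢ head (g (not a ∷ u₀))) where

    here-image : ∀ u → head (g (a ∷ u)) ≡ c xor a × head (g (not a ∷ u)) ≡ not (c xor a)
                     × tail (g (a ∷ u)) ≡ tail (g (not a ∷ u))
    here-image u =
      Step-at-head (preserves-Step E (here a u))
        (dim≡just-zero⇒head-≢ (g (a ∷ u)) (g (not a ∷ u))
          (trans (here-dim u) (dim-head-≢ (g (a ∷ u₀)) (g (not a ∷ u₀)) splits)))

    head-image : ∀ x u → head (g (x ∷ u)) ≡ c xor x
    head-image x u = Bool-cases (λ x → head (g (x ∷ u)) ≡ c xor x) (proj₁ (here-image u))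
      (trans (proj₁ (proj₂ (here-image u))) (not-distribʳ-xor c a)) x

    tail-image : ∀ x u → tail (g (x ∷ u)) ≡ tail (g (a ∷ u))
    tail-image x u = Bool-cases (λ x → tail (g (x ∷ u)) ≡ tail (g (a ∷ u))) refl
      (sym (proj₂ (proj₂ (here-image u)))) x

    star-embedding : IsCubeEmbedding true false (λ u → tail (g (a ∷ u)))
    star-embedding = record
      { preserves-Step   = λ {s} {t} e →
          subst (λ d → Step d _ _) (xor-inverseˡ (c xor a))
                (Step-tail (preserves-Step E (lift-Step e)) (head-image a s) (head-image a t))
      ; preserves-dim    = λ {s₁} {t₁} {s₂} {t₂} e₁ e₂ d →
          dim-tails (g (a ∷ s₁)) (g (a ∷ t₁)) (g (a ∷ s₂)) (g (a ∷ t₂))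
                    (same-head s₁ t₁) (same-head s₂ t₂)
                    (preserves-dim E (lift-Step e₁) (lift-Step e₂) (dim-∷-cong a a d))
      ; vertex-injective = λ {s} {t} p →
          ∷-injectiveʳ (vertex-injective E (head-tail-≡ (same-head s t) p))
      }
      where
      lift-Step : ∀ {s t} → Step true s t → Step a (a ∷ s) (a ∷ t)
      lift-Step e = there a (subst (λ d → Step d _ _) (sym (xor-inverseˡ a)) e)
      same-head : ∀ s t → head (g (a ∷ s)) ≡ head (g (a ∷ t))
      same-head s t = trans (head-image a s) (sym (head-image a t))

    prepend-star : (∃ λ S → embed false S ≗ λ u → tail (g (a ∷ u))) → ∃ λ S → embed c S ≗ g
    prepend-star (S , p) = ⋆∷ S , λ { (x ∷ u) →
      head-tail-≡ (sym (head-image x u)) (trans (p u) (sym (tail-image x u))) }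

  module _ (keeps : head (g (a ∷ u₀)) ≡ head (g (not a ∷ u₀))) where

    here-keeps-head : ∀ u → head (g (a ∷ u)) ≡ head (g (not a ∷ u))
    here-keeps-head u = dim≢just-zero⇒head-≡ (g (a ∷ u)) (g (not a ∷ u)) λ p →
      dim≡just-zero⇒head-≢ (g (a ∷ u₀)) (g (not a ∷ u₀)) (trans (sym (here-dim u)) p) keeps

    flip-keeps-head : ∀ x u → head (g (x ∷ u)) ≡ head (g (not x ∷ u))
    flip-keeps-head x u =
      Bool-cases (λ x → head (g (x ∷ u)) ≡ head (g (not x ∷ u))) (here-keeps-head u)
        (trans (sym (here-keeps-head u)) (cong (λ b → head (g (b ∷ u))) (sym (not-involutive a)))) x

    -- A step in a later direction that moved the head would go from c xor a to
    -- its negation; so would the reversed step on the opposite side, which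
    -- contradicts flip-keeps-head.
    Step-keeps-head : ∀ {s t} → Step a s t → head (g s) ≡ head (g t)
    Step-keeps-head (here a u) = here-keeps-head u
    Step-keeps-head (there x {s} {t} e) with head (g (x ∷ s)) ≟ head (g (x ∷ t))
    ... | yes p = p
    ... | no moved = ⊥-elim (not-¬ refl (trans (sym from-x) (trans (flip-keeps-head x s) from-not-x)))
      where
      e′ : Step a (not x ∷ t) (not x ∷ s)
      e′ = there (not x) (subst (λ d → Step d t s) (not-distribˡ-xor (not x) a) (Step-reverse e))
      same-dim : dim (x ∷ s) (x ∷ t) ≡ dim (not x ∷ t) (not x ∷ s)
      same-dim = dim-∷-cong x (not x) (dim-sym s t)
      moved-at-zero : dim (g (x ∷ s)) (g (x ∷ t)) ≡ just zero
      moved-at-zero = dim-head-≢ (g (x ∷ s)) (g (x ∷ t)) moved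
      from-x : head (g (x ∷ s)) ≡ c xor a
      from-x = proj₁ (Step-at-head (preserves-Step E (there x e)) moved)
      from-not-x : head (g (not x ∷ s)) ≡ not (c xor a)
      from-not-x = proj₁ (proj₂ (Step-at-head (preserves-Step E e′)
        (dim≡just-zero⇒head-≢ (g (not x ∷ t)) (g (not x ∷ s))
          (trans (sym (preserves-dim E (there x e) e′ same-dim)) moved-at-zero))))

    head-constant : ∀ v → head (g v) ≡ head (g (a ∷ u₀))
    head-constant v = constant-along-Step (head ∘ g) Step-keeps-head v (a ∷ u₀)

classify : ∀ a c (g : Vertex m → Vertex n) → IsCubeEmbedding a c g → ∃ λ S → embed c S ≗ g
classify {m = zero}  {n = zero}  a c g E = [] , λ { [] → Vertex₀-unique (g []) }
classify {m = suc m} {n = zero}  a c g E =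
  ⊥-elim (not-¬ refl (∷-injectiveˡ (vertex-injective E (trans (sym (Vertex₀-unique (g (a ∷ u₀))))
                                                              (Vertex₀-unique (g (not a ∷ u₀)))))))
  where u₀ = replicate m false
classify {m = zero}  {n = suc n} a c g E =
  prepend-fixed E (λ { [] → refl }) (classify a _ (tail ∘ g) (tail-embedding E λ { [] → refl }))
classify {m = suc m} {n = suc n} a c g E with head (g (a ∷ u₀)) ≟ head (g (not a ∷ u₀))
  where u₀ = replicate m false
... | yes keeps  = prepend-fixed E hc (classify a _ _ (tail-embedding E hc))
  where hc = head-constant E keeps
... | no  splits = prepend-star E splits (classify true false _ (star-embedding E splits))

embeddingBijection : Bijection (setoid (Subcube n m)) (DPInjMorphismSetoid m n)
embeddingBijection = record
  { to        = embedding
  ; cong      = λ { refl v → refl }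
  ; bijective = (λ {S} {T} → embed-determines-Subcube false S T)
              , λ g → let S , p = classify false false (fun g) (DPInjMorphism⇒IsCubeEmbedding g)
                      in S , λ { refl → p }
  }

lemma3p13 : (m n : ℕ) → Bijection (FaceSetoid n m) (DPInjMorphismSetoid m n)
lemma3p13 m n =
  Composition.bijection (Inverse⇒Bijection (Symmetry.inverse (Bijection⇒Inverse faceBijection)))
                        embeddingBijection
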